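{- Let $b,k,n$ be positive integers with $b\leq n$ and $k\leq n$. Then $$\gamma_{MB}(P_n^k,b)=\left\lceil \frac{n-1}{b(2k+1)-1}\right\rceil \quad\text{and}\quad \gamma_{MB}(C_n^k,b)=\left\lceil \frac{n-1}{b(2k+1)-1}\right\rceil .$$
   Context: $P_n$ is the path with vertices $v_1,\dots,v_n$ and edges $v_iv_{i+1}$ ($1\le i\le n-1$); $C_n$ is the cycle obtained by adding the edge $v_nv_1$. For a graph $G$, its $k$-th power $G^k$ has the same vertex set, with an edge between any two distinct vertices of distance at most $k$ in $G$. The $b$-biased Maker-Breaker domination game on a finite graph $G$: two players, Dominator and Staller, alternately claim previously unclaimed vertices of $G$; in each of her turns Dominator claims up to $b$ vertices, in each of his turns Staller claims one vertex. A round consists of one turn of each player. Dominator wins if the set of vertices she claims contains a dominating set of $G$ (a set $D$ such that every vertex outside $D$ has a neighbour in $D$); otherwise Staller wins. $\gamma_{MB}(G,b)$ is the smallest number of rounds within which Dominator can guarantee to win when Dominator makes the first move (both players playing optimally), and $\gamma_{MB}(G,b)=\infty$ if Staller has a winning strategy. -}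

module Defs where

open import Data.Nat using (ℕ; zero; suc; _+_; _*_; _∸_; _≤_)
open import Data.Nat.DivMod using (_/_)
open import Data.Fin using (Fin; toℕ)
open import Data.Fin.Subset using (Subset; _∈_; _∉_; _∪_; ⁅_⁆; ∣_∣) renaming (⊥ to ∅)
open import Data.Product using (Σ; ∃; _×_)
open import Data.Sum using (_⊎_)
open import Data.Empty using () renaming (⊥ to Empty)
open import Relation.Binary.PropositionalEquality using (_≡_; _≢_)

Graph : ℕ → Set₁
Graph n = Fin n → Fin n → Set

-- Path P_n: vertices v_1..v_n are Fin n (v_i = index i-1); edges v_i v_{i+1}.
PathEdge : (n : ℕ) → Graph n
PathEdge n i j = (suc (toℕ i) ≡ toℕ j) ⊎ (suc (toℕ j) ≡ toℕ i)

CycleEdge : (n : ℕ) → Graph n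
CycleEdge n i j =
  PathEdge n i j
  ⊎ ((toℕ i ≡ 0 × suc (toℕ j) ≡ n) ⊎ (toℕ j ≡ 0 × suc (toℕ i) ≡ n))

data Walk {n : ℕ} (G : Graph n) : ℕ → Fin n → Fin n → Set where
  nil  : ∀ {v} → Walk G 0 v v
  cons : ∀ {l u w v} → G u w → Walk G l w v → Walk G (suc l) u v

DistLe : {n : ℕ} → Graph n → ℕ → Fin n → Fin n → Set
DistLe G k u v = Σ ℕ λ l → l ≤ k × Walk G l u v

Power : {n : ℕ} → Graph n → ℕ → Graph n
Power G k u v = u ≢ v × DistLe G k u v

Dominates : {n : ℕ} → Graph n → Subset n → Set
Dominates {n} G D = ∀ (v : Fin n) → v ∈ D ⊎ (Σ (Fin n) λ u → u ∈ D × G u v)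

-- DomWins G b r D S : in the b-biased Maker-Breaker domination game on G,
-- at a position where Dominator has claimed D, Staller has claimed S, and it is
-- Dominator's turn, Dominator can guarantee to win within r further rounds.
-- In her turn Dominator claims a set T of at most b unclaimed vertices; if her
-- vertices then dominate G she has won; otherwise Staller must claim an
-- unclaimed vertex (if none is left the game is over and Staller has won), and
-- whatever he claims, Dominator must be able to win within the remaining rounds.
DomWins : {n : ℕ} → Graph n → ℕ → ℕ → Subset n → Subset n → Set
DomWins G b zero D S = Empty
DomWins {n} G b (suc r) D S =
  Σ (Subset n) λ T →
    (∣ T ∣ ≤ b)
    × (∀ (v : Fin n) → v ∈ T → v ∉ D × v ∉ S)
    × (Dominates G (D ∪ T)
       ⊎ ((Σ (Fin n) λ w → w ∉ D ∪ T × w ∉ S)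
          × (∀ (v : Fin n) → v ∉ D ∪ T → v ∉ S →
               DomWins G b r (D ∪ T) (S ∪ ⁅ v ⁆))))

GammaMB≡ : {n : ℕ} → Graph n → ℕ → ℕ → Set
GammaMB≡ G b m = DomWins G b m ∅ ∅ × (∀ (r : ℕ) → DomWins G b r ∅ ∅ → m ≤ r)

-- ⌈ a / d ⌉ for d ≥ 1 (value at d = 0 is irrelevant).
ceilDiv : ℕ → ℕ → ℕ
ceilDiv a zero = 0
ceilDiv a (suc d) = (a + d) / suc d

-- Write d = b(2k+1) − 1 and call v_{p+1} position p.
--
-- Upper bound, on P_n^k and hence on its supergraph C_n^k: cut the positions 0, …, n−1 into
-- M = ⌈(n−1)/d⌉ − 1 blocks [jd, jd + d) and a tail [Md, n−1] of at most d + 1 positions.  A block is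
-- dominated both by its b positions jd + i(2k+1) + k and by its b positions jd + i(2k+1) + k − 1
-- (i < b), two disjoint sets, and the tail by b positions of the first kind.  Dominator claims the
-- tail set first and then plays a pairing strategy on the blocks, settling one block per round.
--
-- Lower bound, on C_n^k and hence on its subgraph P_n^k: the territory of a position is the union of
-- the arcs (x, x + j] with x Dominator's, j ≤ 2k+1, no Dominator vertex strictly inside and x + j not
-- Staller's.  A Dominator turn adds at most b(2k+1) = d + 1 vertices to it, a dominating set has all
-- n vertices in its territory, and until Dominator wins Staller can remove a vertex from it: he claims
-- the last free vertex among the 2k+1 vertices following a Dominator vertex x that has no Dominator
-- vertex among them, unless he owns all of them, and then x + k + 1 can never be dominated.
-- Hence n ≤ rd + 1 if Dominator wins within r rounds.

module Submission where

open import Defs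
open import Data.Nat using (ℕ; zero; suc; pred; _+_; _*_; _∸_; _≤_; _<_; z≤n; s≤s; NonZero; _⊓_; ∣_-_∣; _≤?_; _<?_)
open import Data.Nat.Properties
open import Data.Nat.DivMod
  using ( _%_; _/_; _mod_; m%n<n; m<n⇒m%n≡m; m≡m%n+[m/n]*n; m<n*o⇒m/o<n; %-distribˡ-+; m%n%n≡m%n
        ; [m+kn]%n≡m%n; n%n≡0; m*n%n≡0; +-distrib-/-∣ʳ; m<n⇒m/n≡0; m*n/n≡m; /-congˡ; m≥n⇒m/n>0; m/n*n≤m )
open import Data.Nat.Divisibility using (n∣m*n)
open import Data.Nat.Tactic.RingSolver using (solve-∀)
open import Data.Fin using (Fin; toℕ; fromℕ<) renaming (zero to fzero; suc to fsuc; _≟_ to _≟ᶠ_)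
open import Data.Fin.Properties using (toℕ-injective; toℕ-fromℕ<; toℕ<n; any?; all?; ¬∀⟶∃¬)
open import Data.Fin.Subset
  using (Subset; _∈_; _∉_; _∪_; _─_; _⊆_; _⊂_; ⁅_⁆; ∣_∣; ⊤; Nonempty; inside; outside) renaming (⊥ to ∅)
open import Data.Fin.Subset.Properties
  using ( ∉⊥; ∈⊤; x∈⁅x⁆; x∈⁅y⁆⇒x≡y; x∈p∪q⁻; p⊆p∪q; q⊆p∪q; _∈?_; nonempty?; ∣⊥∣≡0; ∣⊤∣≡n; ∣⁅x⁆∣≡1
        ; p⊆q⇒∣p∣≤∣q∣; p⊂q⇒∣p∣<∣q∣; x∈p⇒∣p-x∣<∣p∣; x∈p∧x≢y⇒x∈p-y; p─q⊆p )
open import Data.Vec using ([]; _∷_; tabulate; here; there)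
open import Data.Vec.Properties using (lookup∘tabulate; []=⇒lookup; lookup⇒[]=)
open import Data.Product using (Σ; ∃; ∃₂; _×_; _,_; proj₁; proj₂)
open import Data.Sum using (_⊎_; inj₁; inj₂; [_,_]′)
open import Function using (_∘_)
open import Relation.Nullary using (¬_; Dec; yes; no; does; contradiction)
open import Relation.Nullary.Decidable using (_×-dec_; _→-dec_; ¬?; map′; decidable-stable)
open import Relation.Unary using (Pred; Decidable)
open import Relation.Binary.Definitions using (tri<; tri≈; tri>)
open import Relation.Binary.PropositionalEquality using (_≡_; _≢_; refl; sym; trans; cong; cong₂; subst; module ≡-Reasoning)

-- Finite sets

∣p∪q∣≤∣p∣+∣q∣ : ∀ {n} (p q : Subset n) → ∣ p ∪ q ∣ ≤ ∣ p ∣ + ∣ q ∣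
∣p∪q∣≤∣p∣+∣q∣ []            []            = z≤n
∣p∪q∣≤∣p∣+∣q∣ (inside ∷ p)  (inside ∷ q)  = s≤s (≤-trans (∣p∪q∣≤∣p∣+∣q∣ p q) (+-monoʳ-≤ ∣ p ∣ (n≤1+n ∣ q ∣)))
∣p∪q∣≤∣p∣+∣q∣ (inside ∷ p)  (outside ∷ q) = s≤s (∣p∪q∣≤∣p∣+∣q∣ p q)
∣p∪q∣≤∣p∣+∣q∣ (outside ∷ p) (inside ∷ q)  = ≤-trans (s≤s (∣p∪q∣≤∣p∣+∣q∣ p q)) (≤-reflexive (sym (+-suc ∣ p ∣ ∣ q ∣)))
∣p∪q∣≤∣p∣+∣q∣ (outside ∷ p) (outside ∷ q) = ∣p∪q∣≤∣p∣+∣q∣ p q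

x∉p─⁅x⁆ : ∀ {n} (p : Subset n) (x : Fin n) → x ∉ p ─ ⁅ x ⁆
x∉p─⁅x⁆ (_ ∷ p) fzero    ()
x∉p─⁅x⁆ (_ ∷ p) (fsuc x) (there x∈) = x∉p─⁅x⁆ p x x∈

x∉p∪⁅y⁆ : ∀ {n} {p : Subset n} {x y} → x ∉ p → x ≢ y → x ∉ p ∪ ⁅ y ⁆
x∉p∪⁅y⁆ {p = p} {y = y} x∉p x≢y x∈ = [ x∉p , x≢y ∘ x∈⁅y⁆⇒x≡y y ]′ (x∈p∪q⁻ p ⁅ y ⁆ x∈)

imageBelow : ∀ {n} → ℕ → (ℕ → Fin n) → Subset n
imageBelow zero    f = ∅
imageBelow (suc m) f = ⁅ f m ⁆ ∪ imageBelow m f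

∣imageBelow∣≤ : ∀ {n} m (f : ℕ → Fin n) → ∣ imageBelow m f ∣ ≤ m
∣imageBelow∣≤ {n} zero f = ≤-reflexive (∣⊥∣≡0 n)
∣imageBelow∣≤ (suc m) f = begin
  ∣ ⁅ f m ⁆ ∪ imageBelow m f ∣       ≤⟨ ∣p∪q∣≤∣p∣+∣q∣ ⁅ f m ⁆ (imageBelow m f) ⟩
  ∣ ⁅ f m ⁆ ∣ + ∣ imageBelow m f ∣   ≤⟨ +-mono-≤ (≤-reflexive (∣⁅x⁆∣≡1 (f m))) (∣imageBelow∣≤ m f) ⟩
  suc m                              ∎
  where open ≤-Reasoning

∈imageBelow⁺ : ∀ {n} m (f : ℕ → Fin n) {i} → i < m → f i ∈ imageBelow m f
∈imageBelow⁺ (suc m) f {i} i<1+m with m<1+n⇒m<n∨m≡n i<1+m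
... | inj₁ i<m  = q⊆p∪q ⁅ f m ⁆ _ (∈imageBelow⁺ m f i<m)
... | inj₂ refl = p⊆p∪q (imageBelow m f) (x∈⁅x⁆ (f m))

∈imageBelow⁻ : ∀ {n} m (f : ℕ → Fin n) {v} → v ∈ imageBelow m f → ∃ λ i → i < m × v ≡ f i
∈imageBelow⁻ zero    f v∈ = contradiction v∈ ∉⊥
∈imageBelow⁻ (suc m) f v∈ with x∈p∪q⁻ ⁅ f m ⁆ (imageBelow m f) v∈
... | inj₁ v∈⁅fm⁆ = m , ≤-refl , x∈⁅y⁆⇒x≡y (f m) v∈⁅fm⁆
... | inj₂ v∈img with ∈imageBelow⁻ m f v∈img
...   | i , i<m , v≡fi = i , m<n⇒m<1+n i<m , v≡fi

unionOver : ∀ {m n} → (Fin m → Subset n) → Subset m → Subset n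
unionOver f []            = ∅
unionOver f (inside ∷ p)  = f fzero ∪ unionOver (f ∘ fsuc) p
unionOver f (outside ∷ p) = unionOver (f ∘ fsuc) p

∣unionOver∣≤ : ∀ {m n} c (f : Fin m → Subset n) (p : Subset m) → (∀ z → ∣ f z ∣ ≤ c) → ∣ unionOver f p ∣ ≤ c * ∣ p ∣
∣unionOver∣≤ {n = n} c f [] _ = ≤-reflexive (trans (∣⊥∣≡0 n) (sym (*-zeroʳ c)))
∣unionOver∣≤ c f (inside ∷ p) ∣f∣≤c = begin
  ∣ f fzero ∪ unionOver (f ∘ fsuc) p ∣       ≤⟨ ∣p∪q∣≤∣p∣+∣q∣ (f fzero) _ ⟩
  ∣ f fzero ∣ + ∣ unionOver (f ∘ fsuc) p ∣   ≤⟨ +-mono-≤ (∣f∣≤c fzero) (∣unionOver∣≤ c (f ∘ fsuc) p (∣f∣≤c ∘ fsuc)) ⟩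
  c + c * ∣ p ∣                              ≡⟨ *-suc c ∣ p ∣ ⟨
  c * suc ∣ p ∣                              ∎
  where open ≤-Reasoning
∣unionOver∣≤ c f (outside ∷ p) ∣f∣≤c = ∣unionOver∣≤ c (f ∘ fsuc) p (∣f∣≤c ∘ fsuc)

∈unionOver⁺ : ∀ {m n} (f : Fin m → Subset n) (p : Subset m) {x} z → z ∈ p → x ∈ f z → x ∈ unionOver f p
∈unionOver⁺ f (inside ∷ p)  fzero    here       x∈ = p⊆p∪q _ x∈
∈unionOver⁺ f (inside ∷ p)  (fsuc z) (there z∈) x∈ = q⊆p∪q (f fzero) _ (∈unionOver⁺ (f ∘ fsuc) p z z∈ x∈)
∈unionOver⁺ f (outside ∷ p) (fsuc z) (there z∈) x∈ = ∈unionOver⁺ (f ∘ fsuc) p z z∈ x∈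

module _ {n p} {P : Pred (Fin n) p} (P? : Decidable P) where

  subsetOf : Subset n
  subsetOf = tabulate (does ∘ P?)

  ∈subsetOf⁺ : ∀ {v} → P v → v ∈ subsetOf
  ∈subsetOf⁺ {v} pv with P? v in eq
  ... | yes _  = lookup⇒[]= v subsetOf (trans (lookup∘tabulate (does ∘ P?) v) (cong does eq))
  ... | no ¬pv = contradiction pv ¬pv

  ∈subsetOf⁻ : ∀ {v} → v ∈ subsetOf → P v
  ∈subsetOf⁻ {v} v∈ with P? v | trans (sym (lookup∘tabulate (does ∘ P?) v)) ([]=⇒lookup v∈)
  ... | yes pv | _  = pv
  ... | no _   | ()

-- Bounded search on ℕ

module _ {p} {P : Pred ℕ p} (P? : Decidable P) where

  firstBelow : ∀ m → (∃ λ i → i < m × P i × (∀ {j} → j < i → ¬ P j)) ⊎ (∀ {j} → j < m → ¬ P j)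
  firstBelow zero = inj₂ λ ()
  firstBelow (suc m) with firstBelow m
  ... | inj₁ (i , i<m , pi , below) = inj₁ (i , m<n⇒m<1+n i<m , pi , below)
  ... | inj₂ none with P? m
  ...   | yes pm = inj₁ (m , ≤-refl , pm , none)
  ...   | no ¬pm = inj₂ λ j<1+m → [ none , (λ { refl → ¬pm }) ]′ (m<1+n⇒m<n∨m≡n j<1+m)

  anyUpTo≤? : ∀ m → Dec (∃ λ i → i ≤ m × P i)
  anyUpTo≤? m = map′ (λ (i , i<1+m , pi) → i , ≤-pred i<1+m , pi) (λ (i , i≤m , pi) → i , s≤s i≤m , pi)
                     (anyUpTo? P? (suc m))

  least : ∀ {i} → P i → ∃ λ i₀ → i₀ ≤ i × P i₀ × (∀ {j} → j < i₀ → ¬ P j)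
  least {i} pi with firstBelow (suc i)
  ... | inj₁ (i₀ , i₀<1+i , pi₀ , below) = i₀ , ≤-pred i₀<1+i , pi₀ , below
  ... | inj₂ none = contradiction pi (none ≤-refl)

  greatestUpTo : ∀ m → (∃ λ q → q ≤ m × P q × (∀ {j} → q < j → j ≤ m → ¬ P j)) ⊎ (∀ {j} → j ≤ m → ¬ P j)
  greatestUpTo m with P? m
  ... | yes pm = inj₁ (m , ≤-refl , pm , λ m<j j≤m → contradiction j≤m (<⇒≱ m<j))
  greatestUpTo zero    | no ¬p0 = inj₂ λ { z≤n → ¬p0 }
  greatestUpTo (suc m) | no ¬pm with greatestUpTo m
  ... | inj₁ (q , q≤m , pq , above) = inj₁ (q , m≤n⇒m≤1+n q≤m , pq , λ q<j j≤1+m →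
          [ above q<j ∘ ≤-pred , (λ { refl → ¬pm }) ]′ (m≤n⇒m<n∨m≡n j≤1+m))
  ... | inj₂ none = inj₂ λ j≤1+m → [ none ∘ ≤-pred , (λ { refl → ¬pm }) ]′ (m≤n⇒m<n∨m≡n j≤1+m)

-- The domination game

Dominated : ∀ {n} → Graph n → Subset n → Fin n → Set
Dominated {n} G D v = v ∈ D ⊎ Σ (Fin n) λ u → u ∈ D × G u v

Free : ∀ {n} → Subset n → Subset n → Fin n → Set
Free D S v = v ∉ D × v ∉ S

StallerToMove : ∀ {n} → Graph n → ℕ → ℕ → Subset n → Subset n → Set
StallerToMove {n} G b r D S =
  Dominates G D ⊎ ((Σ (Fin n) (Free D S)) × (∀ v → v ∉ D → v ∉ S → DomWins G b r D (S ∪ ⁅ v ⁆)))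

module _ {n} {G H : Graph n} (G⊆H : ∀ {u v} → G u v → H u v) where

  Walk-map : ∀ {l u v} → Walk G l u v → Walk H l u v
  Walk-map nil        = nil
  Walk-map (cons e w) = cons (G⊆H e) (Walk-map w)

  Dominates-mono : ∀ {D} → Dominates G D → Dominates H D
  Dominates-mono dom v with dom v
  ... | inj₁ v∈D             = inj₁ v∈D
  ... | inj₂ (u , u∈D , guv) = inj₂ (u , u∈D , G⊆H guv)

  DomWins-mono : ∀ {b} r {D S} → DomWins G b r D S → DomWins H b r D S
  DomWins-mono (suc r) (T , ∣T∣≤b , T-free , inj₁ dom) = T , ∣T∣≤b , T-free , inj₁ (Dominates-mono dom)
  DomWins-mono (suc r) (T , ∣T∣≤b , T-free , inj₂ (w , play)) =
    T , ∣T∣≤b , T-free , inj₂ (w , λ v v∉D v∉S → DomWins-mono r (play v v∉D v∉S))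

Power-mono : ∀ {n} {G H : Graph n} k → (∀ {u v} → G u v → H u v) → ∀ {u v} → Power G k u v → Power H k u v
Power-mono k G⊆H (u≢v , l , l≤k , w) = u≢v , l , l≤k , Walk-map G⊆H w

PathPower⊆CyclePower : ∀ {n} k {u v : Fin n} → Power (PathEdge n) k u v → Power (CycleEdge n) k u v
PathPower⊆CyclePower k = Power-mono k inj₁

-- Pairing strategies

-- Dominator claims F, then answers a Staller move inside an unsettled pair A j ∪ B j by the half he
-- avoided, and any other move by settling an arbitrary unsettled pair.
module PairingStrategy
  {n : ℕ} (G : Graph n) (b M : ℕ) (F : Subset n) (A B : Fin M → Subset n)
  (∣F∣≤b : ∣ F ∣ ≤ b) (∣A∣≤b : ∀ j → ∣ A j ∣ ≤ b) (∣B∣≤b : ∀ j → ∣ B j ∣ ≤ b)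
  (A-nonempty : ∀ j → Nonempty (A j))
  (A∩B≡∅ : ∀ j {v} → v ∈ A j → v ∉ B j)
  (pair-unique : ∀ i j {v} → v ∈ A i ∪ B i → v ∈ A j ∪ B j → i ≡ j)
  (F∩pair≡∅ : ∀ j {v} → v ∈ F → v ∉ A j ∪ B j)
  (dominating : ∀ D → F ⊆ D → (∀ j → A j ⊆ D ⊎ B j ⊆ D) → Dominates G D)
  where

  Settled : Subset n → Fin M → Set
  Settled D j = A j ⊆ D ⊎ B j ⊆ D

  Settled-mono : ∀ {D D′ j} → D ⊆ D′ → Settled D j → Settled D′ j
  Settled-mono D⊆D′ (inj₁ A⊆D) = inj₁ (D⊆D′ ∘ A⊆D)
  Settled-mono D⊆D′ (inj₂ B⊆D) = inj₂ (D⊆D′ ∘ B⊆D)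

  record Invariant (r : ℕ) (U : Subset M) (D S : Subset n) : Set where
    field
      F⊆D       : F ⊆ D
      settled   : ∀ j → j ∉ U → Settled D j
      untouched : ∀ j → j ∈ U → ∀ {v} → v ∈ A j ∪ B j → Free D S v
      ∣U∣≤r     : ∣ U ∣ ≤ r

  candidateAvoiding : ∀ D j z → Σ (Subset n) λ T → z ∉ T × ∣ T ∣ ≤ b × T ⊆ A j ∪ B j × Settled (D ∪ T) j
  candidateAvoiding D j z with z ∈? A j
  ... | yes z∈A = B j , A∩B≡∅ j z∈A , ∣B∣≤b j , q⊆p∪q (A j) (B j) , inj₂ (q⊆p∪q D (B j))
  ... | no z∉A  = A j , z∉A , ∣A∣≤b j , p⊆p∪q (B j) , inj₁ (q⊆p∪q D (A j))

  mutual
    stallerToMove : ∀ r {U D S} → Invariant r U D S → StallerToMove G b r D S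
    stallerToMove r {U} inv with nonempty? U
    ... | no U-empty = inj₁ (dominating _ F⊆D λ j → settled j λ j∈U → U-empty (j , j∈U))
      where open Invariant inv
    ... | yes (j , j∈U) = inj₂ ((a , Invariant.untouched inv j j∈U (p⊆p∪q (B j) a∈A)) , dominatorReply r inv j∈U)
      where
      a   = proj₁ (A-nonempty j)
      a∈A = proj₂ (A-nonempty j)

    dominatorReply : ∀ r {U D S j} → Invariant r U D S → j ∈ U → ∀ z → z ∉ D → z ∉ S → DomWins G b r D (S ∪ ⁅ z ⁆)
    dominatorReply zero    inv j∈U _ _ _ = contradiction (≤-trans (x∈p⇒∣p-x∣<∣p∣ j∈U) (Invariant.∣U∣≤r inv)) λ ()
    dominatorReply (suc r) {U} inv j∈U z _ _ with any? (λ i → (i ∈? U) ×-dec (z ∈? (A i ∪ B i)))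
    ... | yes (i , i∈U , z∈i) = settle r inv i∈U z λ i′ _ z∈i′ → pair-unique i′ i z∈i′ z∈i
    ... | no none             = settle r inv j∈U z λ i′ i′∈U z∈i′ → contradiction (i′ , i′∈U , z∈i′) none

    settle : ∀ r {U D S j} → Invariant (suc r) U D S → j ∈ U → ∀ z →
             (∀ i → i ∈ U → z ∈ A i ∪ B i → i ≡ j) → DomWins G b (suc r) D (S ∪ ⁅ z ⁆)
    settle r {U} {D} {S} {j} inv j∈U z z-only-in-j with candidateAvoiding D j z
    ... | T , z∉T , ∣T∣≤b , T⊆pair , settled-j = T , ∣T∣≤b , T-free , stallerToMove r inv′
      where
      open Invariant inv

      T-free : ∀ v → v ∈ T → Free D (S ∪ ⁅ z ⁆) v
      T-free v v∈T with untouched j j∈U (T⊆pair v∈T)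
      ... | v∉D , v∉S = v∉D , x∉p∪⁅y⁆ v∉S λ { refl → z∉T v∈T }

      inv′ : Invariant r (U ─ ⁅ j ⁆) (D ∪ T) (S ∪ ⁅ z ⁆)
      inv′ = record
        { F⊆D       = p⊆p∪q T ∘ F⊆D
        ; settled   = settled′
        ; untouched = untouched′
        ; ∣U∣≤r     = ≤-pred (≤-trans (x∈p⇒∣p-x∣<∣p∣ j∈U) ∣U∣≤r)
        }
        where
        settled′ : ∀ i → i ∉ U ─ ⁅ j ⁆ → Settled (D ∪ T) i
        settled′ i i∉U-j with i ≟ᶠ j
        ... | yes refl = settled-j
        ... | no i≢j   = Settled-mono (p⊆p∪q T) (settled i λ i∈U → i∉U-j (x∈p∧x≢y⇒x∈p-y i∈U i≢j))
        untouched′ : ∀ i → i ∈ U ─ ⁅ j ⁆ → ∀ {v} → v ∈ A i ∪ B i → Free (D ∪ T) (S ∪ ⁅ z ⁆) v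
        untouched′ i i∈U-j {v} v∈i =
          v∉D∪T , x∉p∪⁅y⁆ (proj₂ (untouched i i∈U v∈i)) λ { refl → i≢j (z-only-in-j i i∈U v∈i) }
          where
          i∈U = p─q⊆p U ⁅ j ⁆ i∈U-j
          i≢j : i ≢ j
          i≢j refl = x∉p─⁅x⁆ U j i∈U-j
          v∉D∪T : v ∉ D ∪ T
          v∉D∪T v∈D∪T = [ proj₁ (untouched i i∈U v∈i) , (λ v∈T → i≢j (pair-unique i j v∈i (T⊆pair v∈T))) ]′
                          (x∈p∪q⁻ D T v∈D∪T)

  pairingStrategy : DomWins G b (suc M) ∅ ∅
  pairingStrategy = F , ∣F∣≤b , (λ _ _ → ∉⊥ , ∉⊥) , stallerToMove M initial
    where
    initial : Invariant M ⊤ (∅ ∪ F) ∅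
    initial = record
      { F⊆D       = q⊆p∪q ∅ F
      ; settled   = λ j j∉⊤ → contradiction ∈⊤ j∉⊤
      ; untouched = λ j _ v∈pair →
          (λ v∈∅∪F → [ ∉⊥ , (λ v∈F → F∩pair≡∅ j v∈F v∈pair) ]′ (x∈p∪q⁻ ∅ F v∈∅∪F)) , ∉⊥
      ; ∣U∣≤r     = ≤-reflexive (∣⊤∣≡n M)
      }

-- Powers of paths

module _ {N : ℕ} where

  pathWalkUp : ∀ l {u v : Fin N} → toℕ u + l ≡ toℕ v → Walk (PathEdge N) l u v
  pathWalkUp zero {u} u+0≡v with toℕ-injective (trans (sym (+-identityʳ (toℕ u))) u+0≡v)
  ... | refl = nil
  pathWalkUp (suc l) {u} {v} u+1+l≡v = cons (inj₁ (sym (toℕ-fromℕ< u+1<N))) (pathWalkUp l w+l≡v)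
    where
    1+u+l≡v : suc (toℕ u) + l ≡ toℕ v
    1+u+l≡v = trans (sym (+-suc (toℕ u) l)) u+1+l≡v
    u+1<N : suc (toℕ u) < N
    u+1<N = ≤-<-trans (m≤m+n (suc (toℕ u)) l) (subst (_< N) (sym 1+u+l≡v) (toℕ<n v))
    w+l≡v : toℕ (fromℕ< u+1<N) + l ≡ toℕ v
    w+l≡v = trans (cong (_+ l) (toℕ-fromℕ< u+1<N)) 1+u+l≡v

  pathWalkDown : ∀ l {u v : Fin N} → toℕ v + l ≡ toℕ u → Walk (PathEdge N) l u v
  pathWalkDown zero {u} {v} v+0≡u with toℕ-injective (trans (sym (+-identityʳ (toℕ v))) v+0≡u)
  ... | refl = nil
  pathWalkDown (suc l) {u} {v} v+1+l≡u =
    cons (inj₂ (trans (cong suc (toℕ-fromℕ< v+l<N)) 1+v+l≡u)) (pathWalkDown l (sym (toℕ-fromℕ< v+l<N)))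
    where
    1+v+l≡u : suc (toℕ v + l) ≡ toℕ u
    1+v+l≡u = trans (sym (+-suc (toℕ v) l)) v+1+l≡u
    v+l<N : toℕ v + l < N
    v+l<N = subst (_≤ N) (sym 1+v+l≡u) (<⇒≤ (toℕ<n u))

  pathWalk : ∀ (u v : Fin N) → Walk (PathEdge N) ∣ toℕ u - toℕ v ∣ u v
  pathWalk u v with ≤-total (toℕ u) (toℕ v)
  ... | inj₁ u≤v = subst (λ l → Walk _ l u v) (sym (m≤n⇒∣m-n∣≡n∸m u≤v)) (pathWalkUp _ (m+[n∸m]≡n u≤v))
  ... | inj₂ v≤u = subst (λ l → Walk _ l u v) (sym (m≤n⇒∣n-m∣≡n∸m v≤u)) (pathWalkDown _ (m+[n∸m]≡n v≤u))

  pathPower-dominated : ∀ {k D} {u v : Fin N} → u ∈ D → ∣ toℕ u - toℕ v ∣ ≤ k →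
                        Dominated (Power (PathEdge N) k) D v
  pathPower-dominated {u = u} {v} u∈D close with u ≟ᶠ v
  ... | yes refl = inj₁ u∈D
  ... | no u≢v   = inj₂ (u , u∈D , u≢v , _ , close , pathWalk u v)

∣m-n∣≤o : ∀ {m n o} → m ≤ n + o → n ≤ m + o → ∣ m - n ∣ ≤ o
∣m-n∣≤o {m} {n} m≤n+o n≤m+o with ∣m-n∣≡[m∸n]∨[n∸m] m n
... | inj₁ ∣m-n∣≡m∸n = ≤-trans (≤-reflexive ∣m-n∣≡m∸n) (m≤n+o⇒m∸n≤o m n m≤n+o)
... | inj₂ ∣m-n∣≡n∸m = ≤-trans (≤-reflexive ∣m-n∣≡n∸m) (m≤n+o⇒m∸n≤o n m n≤m+o)

2k+1≡1+k+k : ∀ k → 2 * k + 1 ≡ suc (k + k)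
2k+1≡1+k+k = solve-∀

[1+b₀][2k+1]∸1≡k+k+b₀[2k+1] : ∀ b₀ k₀ → let k = suc k₀ in
                              suc b₀ * (2 * k + 1) ∸ 1 ≡ k + k + b₀ * (2 * k + 1)
[1+b₀][2k+1]∸1≡k+k+b₀[2k+1] b₀ k₀ = cong (_∸ 1) (lemma b₀ k₀)
  where
  lemma : ∀ b₀ k₀ → suc b₀ * (2 * suc k₀ + 1) ≡ suc (suc k₀ + suc k₀ + b₀ * (2 * suc k₀ + 1))
  lemma = solve-∀

module _ (k₀ : ℕ) where

  private
    k = suc k₀
    c = 2 * k + 1

  nearestOffset : ∀ b {t} → t < b * c → ∃ λ i → i < b × ∣ t - (i * c + k) ∣ ≤ k
  nearestOffset b {t} t<bc = t / c , m<n*o⇒m/o<n t<bc , (begin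
    ∣ t - (i * c + k) ∣          ≡⟨ cong ∣_- i * c + k ∣ (trans (m≡m%n+[m/n]*n t c) (+-comm ρ (i * c))) ⟩
    ∣ i * c + ρ - i * c + k ∣    ≡⟨ ∣m+n-m+o∣≡∣n-o∣ (i * c) ρ k ⟩
    ∣ ρ - k ∣                    ≤⟨ ∣m-n∣≤o (≤-pred (subst (ρ <_) (2k+1≡1+k+k k) (m%n<n t c))) (m≤n+m k ρ) ⟩
    k                            ∎)
    where
    open ≤-Reasoning
    i = t / c
    ρ = t % c

  nearestPredOffset : ∀ b {t} → suc t < b * c → ∃ λ i → i < b × ∣ t - (i * c + k₀) ∣ ≤ k
  nearestPredOffset b {t} 1+t<bc with t % c ≤? k₀ + k
  ... | yes ρ≤k₀+k = i , m<n*o⇒m/o<n (<-trans (n<1+n t) 1+t<bc) , (begin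
    ∣ t - (i * c + k₀) ∣         ≡⟨ cong ∣_- i * c + k₀ ∣ t≡ic+ρ ⟩
    ∣ i * c + ρ - i * c + k₀ ∣   ≡⟨ ∣m+n-m+o∣≡∣n-o∣ (i * c) ρ k₀ ⟩
    ∣ ρ - k₀ ∣                   ≤⟨ ∣m-n∣≤o ρ≤k₀+k (≤-trans (n≤1+n k₀) (m≤n+m k ρ)) ⟩
    k                            ∎)
    where
    open ≤-Reasoning
    i = t / c
    ρ = t % c
    t≡ic+ρ : t ≡ i * c + ρ
    t≡ic+ρ = trans (m≡m%n+[m/n]*n t c) (+-comm ρ (i * c))
  ... | no ρ≰k₀+k = suc i , *-cancelʳ-< c (suc i) b (subst (_< b * c) (sym 1+i*c≡1+t) 1+t<bc) , (begin
    ∣ t - (suc i * c + k₀) ∣     ≡⟨ cong ∣ t -_∣ 1+i*c+k₀≡t+k ⟩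
    ∣ t - t + k ∣                ≡⟨ ∣m-m+n∣≡n t k ⟩
    k                            ∎)
    where
    open ≤-Reasoning
    i = t / c
    ρ = t % c
    ρ≡k₀+1+k : ρ ≡ suc (k₀ + k)
    ρ≡k₀+1+k = ≤-antisym (≤-pred (subst (ρ <_) (2k+1≡1+k+k k) (m%n<n t c))) (≰⇒> ρ≰k₀+k)
    t≡ic+1+k₀+k : t ≡ i * c + suc (k₀ + k)
    t≡ic+1+k₀+k = trans (m≡m%n+[m/n]*n t c) (trans (+-comm ρ (i * c)) (cong (i * c +_) ρ≡k₀+1+k))
    1+i*c≡1+t : suc i * c ≡ suc t
    1+i*c≡1+t = trans (lemma i k₀) (cong suc (sym t≡ic+1+k₀+k))
      where
      lemma : ∀ i k₀ → suc i * (2 * suc k₀ + 1) ≡ suc (i * (2 * suc k₀ + 1) + suc (k₀ + suc k₀))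
      lemma = solve-∀
    1+i*c+k₀≡t+k : suc i * c + k₀ ≡ t + k
    1+i*c+k₀≡t+k = trans (lemma i k₀) (cong (_+ k) (sym t≡ic+1+k₀+k))
      where
      lemma : ∀ i k₀ → suc i * (2 * suc k₀ + 1) + k₀ ≡ i * (2 * suc k₀ + 1) + suc (k₀ + suc k₀) + suc k₀
      lemma = solve-∀

module PathBlocks (b₀ k₀ n M : ℕ)
  (M*d≤n : M * (suc b₀ * (2 * suc k₀ + 1) ∸ 1) ≤ n)
  (n≤M*d+d : n ≤ M * (suc b₀ * (2 * suc k₀ + 1) ∸ 1) + (suc b₀ * (2 * suc k₀ + 1) ∸ 1))
  where

  b = suc b₀
  k = suc k₀
  c = 2 * k + 1
  d = b * c ∸ 1
  G = Power (PathEdge (suc n)) k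

  d≡k+k+b₀c : d ≡ k + k + b₀ * c
  d≡k+k+b₀c = [1+b₀][2k+1]∸1≡k+k+b₀[2k+1] b₀ k₀

  instance
    d≢0 : NonZero d
    d≢0 = subst NonZero (sym d≡k+k+b₀c) _

  offset<d : ∀ {i o} → i < b → o ≤ k → i * c + o < d
  offset<d {i} {o} i<b o≤k = begin-strict
    i * c + o        ≤⟨ +-mono-≤ (*-monoˡ-≤ c (≤-pred i<b)) o≤k ⟩
    b₀ * c + k       <⟨ +-monoʳ-< (b₀ * c) (m<m+n k (s≤s z≤n)) ⟩
    b₀ * c + (k + k) ≡⟨ +-comm (b₀ * c) (k + k) ⟩
    k + k + b₀ * c   ≡⟨ d≡k+k+b₀c ⟨
    d                ∎
    where open ≤-Reasoning

  -- Tail points beyond the last vertex are clamped to it.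
  at : ℕ → Fin (suc n)
  at p = fromℕ< (s≤s (m⊓n≤n p n))

  toℕ-at : ∀ {p} → p ≤ n → toℕ (at p) ≡ p
  toℕ-at {p} p≤n = trans (toℕ-fromℕ< _) (m≤n⇒m⊓n≡m p≤n)

  ∣v-at∣≤∣v-p∣ : ∀ (v : Fin (suc n)) p → ∣ toℕ v - toℕ (at p) ∣ ≤ ∣ toℕ v - p ∣
  ∣v-at∣≤∣v-p∣ v p with p ≤? n
  ... | yes p≤n = ≤-reflexive (cong ∣ toℕ v -_∣ (toℕ-at p≤n))
  ... | no p≰n  = begin
    ∣ toℕ v - toℕ (at p) ∣ ≡⟨ cong ∣ toℕ v -_∣ (trans (toℕ-fromℕ< _) (m≥n⇒m⊓n≡n (<⇒≤ (≰⇒> p≰n)))) ⟩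
    ∣ toℕ v - n ∣          ≡⟨ m≤n⇒∣m-n∣≡n∸m v≤n ⟩
    n ∸ toℕ v              ≤⟨ ∸-monoˡ-≤ (toℕ v) (<⇒≤ (≰⇒> p≰n)) ⟩
    p ∸ toℕ v              ≡⟨ m≤n⇒∣m-n∣≡n∸m (≤-trans v≤n (<⇒≤ (≰⇒> p≰n))) ⟨
    ∣ toℕ v - p ∣          ∎
    where
    open ≤-Reasoning
    v≤n = ≤-pred (toℕ<n v)

  dominated-from-nearby : ∀ {D} (v : Fin (suc n)) J {t x} → at (J + x) ∈ D → toℕ v ≡ J + t → ∣ t - x ∣ ≤ k →
                          Dominated G D v
  dominated-from-nearby v J {t} {x} at∈D v≡J+t ∣t-x∣≤k = pathPower-dominated at∈D (begin
    ∣ toℕ (at (J + x)) - toℕ v ∣ ≡⟨ ∣-∣-comm (toℕ (at (J + x))) (toℕ v) ⟩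
    ∣ toℕ v - toℕ (at (J + x)) ∣ ≤⟨ ∣v-at∣≤∣v-p∣ v (J + x) ⟩
    ∣ toℕ v - (J + x) ∣          ≡⟨ cong ∣_- J + x ∣ v≡J+t ⟩
    ∣ J + t - (J + x) ∣          ≡⟨ ∣m+n-m+o∣≡∣n-o∣ J t x ⟩
    ∣ t - x ∣                    ≤⟨ ∣t-x∣≤k ⟩
    k                            ∎)
    where open ≤-Reasoning

  blockPos<M*d : ∀ (j : Fin M) {x} → x < d → toℕ j * d + x < M * d
  blockPos<M*d j {x} x<d = begin-strict
    toℕ j * d + x <⟨ +-monoʳ-< (toℕ j * d) x<d ⟩
    toℕ j * d + d ≡⟨ +-comm (toℕ j * d) d ⟩
    suc (toℕ j) * d ≤⟨ *-monoˡ-≤ d (toℕ<n j) ⟩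
    M * d         ∎
    where open ≤-Reasoning

  blockOf : ∀ (j : Fin M) {x} → x < d → (toℕ j * d + x) / d ≡ toℕ j
  blockOf j {x} x<d = begin
    (toℕ j * d + x) / d     ≡⟨ cong (_/ d) (+-comm (toℕ j * d) x) ⟩
    (x + toℕ j * d) / d     ≡⟨ +-distrib-/-∣ʳ x (n∣m*n (toℕ j)) ⟩
    x / d + toℕ j * d / d   ≡⟨ cong₂ _+_ (m<n⇒m/n≡0 x<d) (m*n/n≡m (toℕ j) d) ⟩
    toℕ j                   ∎
    where open ≡-Reasoning

  blockPoint : Fin M → ℕ → ℕ → Fin (suc n)
  blockPoint j o i = at (toℕ j * d + (i * c + o))

  tailPoint : ℕ → Fin (suc n)
  tailPoint i = at (M * d + (i * c + k))

  candidate : Fin M → ℕ → Subset (suc n)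
  candidate j o = imageBelow b (blockPoint j o)

  A B : Fin M → Subset (suc n)
  A j = candidate j k
  B j = candidate j k₀

  F : Subset (suc n)
  F = imageBelow b tailPoint

  ∈candidate⁻ : ∀ j {o v} → o ≤ k → v ∈ candidate j o → ∃ λ i → i < b × toℕ v ≡ toℕ j * d + (i * c + o)
  ∈candidate⁻ j {o} o≤k v∈ with ∈imageBelow⁻ b (blockPoint j o) v∈
  ... | i , i<b , refl = i , i<b , toℕ-at (<⇒≤ (≤-trans (blockPos<M*d j (offset<d i<b o≤k)) M*d≤n))

  candidate-block : ∀ j {o v} → o ≤ k → v ∈ candidate j o → toℕ v / d ≡ toℕ j × toℕ v < M * d
  candidate-block j o≤k v∈ with ∈candidate⁻ j o≤k v∈
  ... | i , i<b , v≡ = trans (/-congˡ v≡) (blockOf j (offset<d i<b o≤k))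
                     , subst (_< M * d) (sym v≡) (blockPos<M*d j (offset<d i<b o≤k))

  pair-block : ∀ j {v} → v ∈ A j ∪ B j → toℕ v / d ≡ toℕ j × toℕ v < M * d
  pair-block j {v} v∈ = [ candidate-block j ≤-refl , candidate-block j (n≤1+n k₀) ]′ (x∈p∪q⁻ (A j) (B j) v∈)

  A∩B≡∅ : ∀ j {v} → v ∈ A j → v ∉ B j
  A∩B≡∅ j v∈A v∈B with ∈candidate⁻ j ≤-refl v∈A | ∈candidate⁻ j (n≤1+n k₀) v∈B
  ... | i , _ , v≡A | i′ , _ , v≡B = 1≢0 (begin
    1                 ≡⟨ m<n⇒m%n≡m (subst (1 <_) (sym (2k+1≡1+k+k k)) (s≤s (s≤s z≤n))) ⟨
    1 % c             ≡⟨ [m+kn]%n≡m%n 1 i c ⟨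
    suc (i * c) % c   ≡⟨ cong (_% c) 1+ic≡i′c ⟩
    i′ * c % c        ≡⟨ m*n%n≡0 i′ c ⟩
    0                 ∎)
    where
    open ≡-Reasoning
    1≢0 : 1 ≢ 0
    1≢0 ()
    1+ic≡i′c : suc (i * c) ≡ i′ * c
    1+ic≡i′c = +-cancelʳ-≡ k₀ _ _ (trans (sym (+-suc (i * c) k₀))
                 (+-cancelˡ-≡ (toℕ j * d) _ _ (trans (sym v≡A) v≡B)))

  dominated-in-block : ∀ {D} (j : Fin M) {v t} → toℕ v ≡ toℕ j * d + t → t < d → A j ⊆ D ⊎ B j ⊆ D →
                       Dominated G D v
  dominated-in-block j {v} v≡ t<d (inj₁ A⊆D) with nearestOffset k₀ b (<-trans t<d (n<1+n d))
  ... | i , i<b , close = dominated-from-nearby v (toℕ j * d) (A⊆D (∈imageBelow⁺ b (blockPoint j k) i<b)) v≡ close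
  dominated-in-block j {v} v≡ t<d (inj₂ B⊆D) with nearestPredOffset k₀ b (s≤s t<d)
  ... | i , i<b , close = dominated-from-nearby v (toℕ j * d) (B⊆D (∈imageBelow⁺ b (blockPoint j k₀) i<b)) v≡ close

  dominated-in-tail : ∀ {D v} → F ⊆ D → M * d ≤ toℕ v → Dominated G D v
  dominated-in-tail {D} {v} F⊆D M*d≤v with nearestOffset k₀ b t<bc
    where
    t<bc : toℕ v ∸ M * d < b * c
    t<bc = s≤s (m≤n+o⇒m∸n≤o (toℕ v) (M * d) (≤-trans (≤-pred (toℕ<n v)) n≤M*d+d))
  ... | i , i<b , close =
    dominated-from-nearby v (M * d) (F⊆D (∈imageBelow⁺ b tailPoint i<b)) (sym (m+[n∸m]≡n M*d≤v)) close

  dominating : ∀ D → F ⊆ D → (∀ j → A j ⊆ D ⊎ B j ⊆ D) → Dominates G D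
  dominating D F⊆D settled v with M * d ≤? toℕ v
  ... | yes M*d≤v = dominated-in-tail F⊆D M*d≤v
  ... | no M*d≰v  = dominated-in-block j v≡ (m%n<n (toℕ v) d) (settled j)
    where
    j<M : toℕ v / d < M
    j<M = m<n*o⇒m/o<n (≰⇒> M*d≰v)
    j = fromℕ< j<M
    v≡ : toℕ v ≡ toℕ j * d + toℕ v % d
    v≡ = trans (m≡m%n+[m/n]*n (toℕ v) d)
               (trans (+-comm (toℕ v % d) _) (cong (λ x → x * d + toℕ v % d) (sym (toℕ-fromℕ< j<M))))

  pathUpperBound : DomWins G b (suc M) ∅ ∅
  pathUpperBound = PairingStrategy.pairingStrategy G b M F A B
    (∣imageBelow∣≤ b tailPoint) (λ j → ∣imageBelow∣≤ b (blockPoint j k)) (λ j → ∣imageBelow∣≤ b (blockPoint j k₀))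
    (λ j → _ , ∈imageBelow⁺ b (blockPoint j k) (s≤s z≤n))
    A∩B≡∅
    (λ i j v∈i v∈j → toℕ-injective (trans (sym (proj₁ (pair-block i v∈i))) (proj₁ (pair-block j v∈j))))
    (λ j v∈F v∈j → <⇒≱ (proj₂ (pair-block j v∈j)) (tail≥M*d v∈F))
    dominating
    where
    tail≥M*d : ∀ {v} → v ∈ F → M * d ≤ toℕ v
    tail≥M*d v∈F with ∈imageBelow⁻ b tailPoint v∈F
    ... | i , _ , refl = subst (M * d ≤_) (sym (toℕ-fromℕ< _)) (⊓-glb (m≤m+n (M * d) _) M*d≤n)

-- Powers of cycles

module _ {n : ℕ} where

  private
    N = suc n

  infixl 6 _⊕_ _⊖_

  _⊕_ : Fin N → ℕ → Fin N
  x ⊕ i = (toℕ x + i) mod N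

  _⊖_ : Fin N → ℕ → Fin N
  x ⊖ i = x ⊕ (i * N ∸ i)

  toℕ-mod : ∀ a → toℕ (a mod N) ≡ a % N
  toℕ-mod a = toℕ-fromℕ< (m%n<n a N)

  mod-cong : ∀ a a′ → a % N ≡ a′ % N → a mod N ≡ a′ mod N
  mod-cong a a′ eq = toℕ-injective (trans (toℕ-mod a) (trans eq (sym (toℕ-mod a′))))

  [m%N+n]%N≡[m+n]%N : ∀ a j → (a % N + j) % N ≡ (a + j) % N
  [m%N+n]%N≡[m+n]%N a j = begin
    (a % N + j) % N             ≡⟨ %-distribˡ-+ (a % N) j N ⟩
    (a % N % N + j % N) % N     ≡⟨ cong (λ m → (m + j % N) % N) (m%n%n≡m%n a N) ⟩
    (a % N + j % N) % N         ≡⟨ %-distribˡ-+ a j N ⟨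
    (a + j) % N                 ∎
    where open ≡-Reasoning

  ⊕-≡ : ∀ x i {y} → toℕ x + i ≡ toℕ y → x ⊕ i ≡ y
  ⊕-≡ x i {y} x+i≡y = toℕ-injective (begin
    toℕ (x ⊕ i)       ≡⟨ toℕ-mod (toℕ x + i) ⟩
    (toℕ x + i) % N   ≡⟨ cong (_% N) x+i≡y ⟩
    toℕ y % N         ≡⟨ m<n⇒m%n≡m (toℕ<n y) ⟩
    toℕ y             ∎)
    where open ≡-Reasoning

  ⊕-assoc : ∀ x i j → x ⊕ i ⊕ j ≡ x ⊕ (i + j)
  ⊕-assoc x i j = mod-cong (toℕ (x ⊕ i) + j) (toℕ x + (i + j)) (begin
    (toℕ (x ⊕ i) + j) % N         ≡⟨ cong (λ m → (m + j) % N) (toℕ-mod (toℕ x + i)) ⟩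
    ((toℕ x + i) % N + j) % N     ≡⟨ [m%N+n]%N≡[m+n]%N (toℕ x + i) j ⟩
    (toℕ x + i + j) % N           ≡⟨ cong (_% N) (+-assoc (toℕ x) i j) ⟩
    (toℕ x + (i + j)) % N         ∎)
    where open ≡-Reasoning

  ⊕-multiple : ∀ x a → x ⊕ a * N ≡ x
  ⊕-multiple x a = toℕ-injective (begin
    toℕ (x ⊕ a * N)       ≡⟨ toℕ-mod (toℕ x + a * N) ⟩
    (toℕ x + a * N) % N   ≡⟨ [m+kn]%n≡m%n (toℕ x) a N ⟩
    toℕ x % N             ≡⟨ m<n⇒m%n≡m (toℕ<n x) ⟩
    toℕ x                 ∎)
    where open ≡-Reasoning

  ⊖-⊕ : ∀ x i → x ⊖ i ⊕ i ≡ x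
  ⊖-⊕ x i = begin
    x ⊕ (i * N ∸ i) ⊕ i   ≡⟨ ⊕-assoc x (i * N ∸ i) i ⟩
    x ⊕ (i * N ∸ i + i)   ≡⟨ cong (x ⊕_) (m∸n+n≡m (m≤m*n i N)) ⟩
    x ⊕ i * N             ≡⟨ ⊕-multiple x i ⟩
    x                     ∎
    where open ≡-Reasoning

  ⊕-⊖ : ∀ x i → x ⊕ i ⊖ i ≡ x
  ⊕-⊖ x i = begin
    x ⊕ i ⊕ (i * N ∸ i)   ≡⟨ ⊕-assoc x i (i * N ∸ i) ⟩
    x ⊕ (i + (i * N ∸ i)) ≡⟨ cong (x ⊕_) (m+[n∸m]≡n (m≤m*n i N)) ⟩
    x ⊕ i * N             ≡⟨ ⊕-multiple x i ⟩
    x                     ∎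
    where open ≡-Reasoning

  ⊕⇒⊖ : ∀ {x y} i → y ⊕ i ≡ x → y ≡ x ⊖ i
  ⊕⇒⊖ {x} {y} i y⊕i≡x = trans (sym (⊕-⊖ y i)) (cong (_⊖ i) y⊕i≡x)

  ⊕-cancelʳ : ∀ {x y} i → x ⊕ i ≡ y ⊕ i → x ≡ y
  ⊕-cancelʳ {x} {y} i eq = trans (⊕⇒⊖ i eq) (⊕-⊖ y i)

  ⊕-∸ : ∀ x {i j} → j ≤ i → x ⊕ j ⊕ (i ∸ j) ≡ x ⊕ i
  ⊕-∸ x {i} {j} j≤i = trans (⊕-assoc x j (i ∸ j)) (cong (x ⊕_) (m+[n∸m]≡n j≤i))

  ⊕-∸-cancel : ∀ {x y i j} → j ≤ i → y ⊕ i ≡ x ⊕ j → y ⊕ (i ∸ j) ≡ x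
  ⊕-∸-cancel {x} {y} {i} {j} j≤i eq = ⊕-cancelʳ j (begin
    y ⊕ (i ∸ j) ⊕ j   ≡⟨ ⊕-assoc y (i ∸ j) j ⟩
    y ⊕ (i ∸ j + j)   ≡⟨ cong (y ⊕_) (m∸n+n≡m j≤i) ⟩
    y ⊕ i             ≡⟨ eq ⟩
    x ⊕ j             ∎)
    where open ≡-Reasoning

  ⊕1-wrap : ∀ x {y} → suc (toℕ x) ≡ N → toℕ y ≡ 0 → x ⊕ 1 ≡ y
  ⊕1-wrap x {y} 1+x≡N y≡0 = toℕ-injective (begin
    toℕ (x ⊕ 1)       ≡⟨ toℕ-mod (toℕ x + 1) ⟩
    (toℕ x + 1) % N   ≡⟨ cong (_% N) (trans (+-comm (toℕ x) 1) 1+x≡N) ⟩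
    N % N             ≡⟨ n%n≡0 N ⟩
    0                 ≡⟨ y≡0 ⟨
    toℕ y             ∎)
    where open ≡-Reasoning

  cycleEdge-step : ∀ {u w} → CycleEdge N u w → u ⊕ 1 ≡ w ⊎ w ⊕ 1 ≡ u
  cycleEdge-step {u} {w} (inj₁ (inj₁ 1+u≡w))       = inj₁ (⊕-≡ u 1 (trans (+-comm (toℕ u) 1) 1+u≡w))
  cycleEdge-step {u} {w} (inj₁ (inj₂ 1+w≡u))       = inj₂ (⊕-≡ w 1 (trans (+-comm (toℕ w) 1) 1+w≡u))
  cycleEdge-step {u} {w} (inj₂ (inj₁ (u≡0 , 1+w≡N))) = inj₂ (⊕1-wrap w 1+w≡N u≡0)
  cycleEdge-step {u} {w} (inj₂ (inj₂ (w≡0 , 1+u≡N))) = inj₁ (⊕1-wrap u 1+u≡N w≡0)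

  cycleWalk-offsets : ∀ {l u v} → Walk (CycleEdge N) l u v → ∃₂ λ a e → a + e ≤ l × u ⊕ a ≡ v ⊕ e
  cycleWalk-offsets nil = 0 , 0 , z≤n , refl
  cycleWalk-offsets (cons {u = u} {w} {v} edge walk) with cycleWalk-offsets walk | cycleEdge-step edge
  ... | a , e , a+e≤l , w⊕a≡v⊕e | inj₁ u⊕1≡w = suc a , e , s≤s a+e≤l , (begin
    u ⊕ suc a     ≡⟨ ⊕-assoc u 1 a ⟨
    u ⊕ 1 ⊕ a     ≡⟨ cong (_⊕ a) u⊕1≡w ⟩
    w ⊕ a         ≡⟨ w⊕a≡v⊕e ⟩
    v ⊕ e         ∎)
    where open ≡-Reasoning
  ... | a , e , a+e≤l , w⊕a≡v⊕e | inj₂ w⊕1≡u = a , suc e , ≤-trans (≤-reflexive (+-suc a e)) (s≤s a+e≤l) , (begin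
    u ⊕ a         ≡⟨ cong (_⊕ a) w⊕1≡u ⟨
    w ⊕ 1 ⊕ a     ≡⟨ ⊕-assoc w 1 a ⟩
    w ⊕ (1 + a)   ≡⟨ cong (w ⊕_) (+-comm 1 a) ⟩
    w ⊕ (a + 1)   ≡⟨ ⊕-assoc w a 1 ⟨
    w ⊕ a ⊕ 1     ≡⟨ cong (_⊕ 1) w⊕a≡v⊕e ⟩
    v ⊕ e ⊕ 1     ≡⟨ ⊕-assoc v e 1 ⟩
    v ⊕ (e + 1)   ≡⟨ cong (v ⊕_) (+-comm e 1) ⟩
    v ⊕ suc e     ∎)
    where open ≡-Reasoning

module CycleTerritory (n k : ℕ) where

  N = suc n
  c = 2 * k + 1
  G = Power (CycleEdge N) k

  c≡1+k+k : c ≡ suc (k + k)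
  c≡1+k+k = 2k+1≡1+k+k k

  Near : Subset N → Fin N → Set
  Near D v = ∃ λ i → i ≤ k + k × v ⊖ k ⊕ i ∈ D

  Near? : ∀ D v → Dec (Near D v)
  Near? D v = anyUpTo≤? (λ i → v ⊖ k ⊕ i ∈? D) (k + k)

  dominated⇒near : ∀ {D v} → Dominated G D v → Near D v
  dominated⇒near {D} {v} (inj₁ v∈D) = k , m≤m+n k k , subst (_∈ D) (sym (⊖-⊕ v k)) v∈D
  dominated⇒near {D} {v} (inj₂ (z , z∈D , _ , l , l≤k , walk)) with cycleWalk-offsets walk
  ... | a , e , a+e≤l , z⊕a≡v⊕e =
    k + e ∸ a , ≤-trans (m∸n≤m (k + e) a) (+-monoʳ-≤ k e≤k) , subst (_∈ D) (sym y≡z) z∈D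
    where
    e≤k : e ≤ k
    e≤k = ≤-trans (m≤n+m e a) (≤-trans a+e≤l l≤k)
    a≤k+e : a ≤ k + e
    a≤k+e = ≤-trans (m≤m+n a e) (≤-trans a+e≤l (≤-trans l≤k (m≤m+n k e)))
    y≡z : v ⊖ k ⊕ (k + e ∸ a) ≡ z
    y≡z = ⊕-cancelʳ a (begin
      v ⊖ k ⊕ (k + e ∸ a) ⊕ a   ≡⟨ ⊕-assoc (v ⊖ k) (k + e ∸ a) a ⟩
      v ⊖ k ⊕ (k + e ∸ a + a)   ≡⟨ cong (v ⊖ k ⊕_) (m∸n+n≡m a≤k+e) ⟩
      v ⊖ k ⊕ (k + e)           ≡⟨ ⊕-assoc (v ⊖ k) k e ⟨
      v ⊖ k ⊕ k ⊕ e             ≡⟨ cong (_⊕ e) (⊖-⊕ v k) ⟩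
      v ⊕ e                     ≡⟨ z⊕a≡v⊕e ⟨
      z ⊕ a                     ∎)
      where open ≡-Reasoning

  occupied-after : ∀ {D} x → Near D (x ⊕ suc k) → ∃ λ j → 1 ≤ j × j ≤ c × x ⊕ j ∈ D
  occupied-after {D} x (i , i≤k+k , y∈D) =
    suc i , s≤s z≤n , subst (suc i ≤_) (sym c≡1+k+k) (s≤s i≤k+k) , subst (_∈ D) y≡x⊕1+i y∈D
    where
    x⊕1≡ : x ⊕ 1 ≡ x ⊕ suc k ⊖ k
    x⊕1≡ = ⊕⇒⊖ k (⊕-assoc x 1 k)
    y≡x⊕1+i : x ⊕ suc k ⊖ k ⊕ i ≡ x ⊕ suc i
    y≡x⊕1+i = trans (cong (_⊕ i) (sym x⊕1≡)) (⊕-assoc x 1 i)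

  occupied-before : ∀ {D} v → Near D (v ⊖ suc k) → ∃ λ i → 1 ≤ i × i ≤ c × v ⊖ i ∈ D
  occupied-before {D} v (i , i≤k+k , y∈D) =
    c ∸ i , m<n⇒0<n∸m i<c , m∸n≤m c i , subst (_∈ D) (⊕⇒⊖ (c ∸ i) y⊕[c∸i]≡v) y∈D
    where
    open ≡-Reasoning
    w = v ⊖ suc k ⊖ k
    i<c : i < c
    i<c = subst (i <_) (sym c≡1+k+k) (s≤s i≤k+k)
    y⊕[c∸i]≡v : w ⊕ i ⊕ (c ∸ i) ≡ v
    y⊕[c∸i]≡v = begin
      w ⊕ i ⊕ (c ∸ i)    ≡⟨ ⊕-∸ w (<⇒≤ i<c) ⟩
      w ⊕ c              ≡⟨ cong (w ⊕_) (trans c≡1+k+k (sym (+-suc k k))) ⟩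
      w ⊕ (k + suc k)    ≡⟨ ⊕-assoc w k (suc k) ⟨
      w ⊕ k ⊕ suc k      ≡⟨ cong (_⊕ suc k) (⊖-⊕ (v ⊖ suc k) k) ⟩
      v ⊖ suc k ⊕ suc k  ≡⟨ ⊖-⊕ v (suc k) ⟩
      v                  ∎

  Disjoint : Subset N → Subset N → Set
  Disjoint D S = ∀ {v} → v ∈ D → v ∉ S

  Gap : Subset N → Fin N → Set
  Gap D x = ∀ {l} → 1 ≤ l → l ≤ c → x ⊕ l ∉ D

  GoodArc : Subset N → Subset N → Fin N → ℕ → Set
  GoodArc D S x j = x ⊕ j ∉ S × (∀ {l} → l < j → 1 ≤ l → x ⊕ l ∉ D)

  GoodArc? : ∀ D S x j → Dec (GoodArc D S x j)
  GoodArc? D S x j = ¬? (x ⊕ j ∈? S) ×-dec allUpTo? (λ l → (1 ≤? l) →-dec ¬? (x ⊕ l ∈? D)) j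

  InTerritory : Subset N → Subset N → Fin N → Set
  InTerritory D S v = ∃ λ x → x ∈ D × ∃ λ j → j ≤ c × GoodArc D S x j × ∃ λ i → i ≤ j × 1 ≤ i × x ⊕ i ≡ v

  InTerritory? : ∀ D S → Decidable (InTerritory D S)
  InTerritory? D S v = any? λ x → (x ∈? D) ×-dec anyUpTo≤? (λ j → GoodArc? D S x j ×-dec
                         anyUpTo≤? (λ i → (1 ≤? i) ×-dec (x ⊕ i ≟ᶠ v)) j) c

  Territory : Subset N → Subset N → Subset N
  Territory D S = subsetOf (InTerritory? D S)

  arc : Fin N → Subset N
  arc z = imageBelow c λ i → z ⊕ suc i

  territory-step : ∀ D T S → Territory (D ∪ T) S ⊆ Territory D S ∪ unionOver arc T
  territory-step D T S v∈ with ∈subsetOf⁻ (InTerritory? (D ∪ T) S) v∈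
  ... | x , x∈D∪T , j , j≤c , (x⊕j∉S , clear) , suc i , 1+i≤j , _ , refl with x∈p∪q⁻ D T x∈D∪T
  ...   | inj₁ x∈D = p⊆p∪q _ (∈subsetOf⁺ (InTerritory? D S)
                       (x , x∈D , j , j≤c , (x⊕j∉S , λ l<j 1≤l → clear l<j 1≤l ∘ p⊆p∪q T) , suc i , 1+i≤j , s≤s z≤n , refl))
  ...   | inj₂ x∈T = q⊆p∪q _ _ (∈unionOver⁺ arc T x x∈T (∈imageBelow⁺ c (λ i → x ⊕ suc i) (≤-trans 1+i≤j j≤c)))

  ∣territory-step∣ : ∀ {b m} D T S → ∣ Territory D S ∣ ≤ m → ∣ T ∣ ≤ b → ∣ Territory (D ∪ T) S ∣ ≤ m + b * c
  ∣territory-step∣ {b} {m} D T S ∣Terr∣≤m ∣T∣≤b = begin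
    ∣ Territory (D ∪ T) S ∣                  ≤⟨ p⊆q⇒∣p∣≤∣q∣ (territory-step D T S) ⟩
    ∣ Territory D S ∪ unionOver arc T ∣      ≤⟨ ∣p∪q∣≤∣p∣+∣q∣ (Territory D S) (unionOver arc T) ⟩
    ∣ Territory D S ∣ + ∣ unionOver arc T ∣  ≤⟨ +-mono-≤ ∣Terr∣≤m (∣unionOver∣≤ c arc T λ z → ∣imageBelow∣≤ c _) ⟩
    m + c * ∣ T ∣                            ≤⟨ +-monoʳ-≤ m (*-monoʳ-≤ c ∣T∣≤b) ⟩
    m + c * b                                ≡⟨ cong (m +_) (*-comm c b) ⟩
    m + b * c                                ∎
    where open ≤-Reasoning

  territory-antitone : ∀ {D S S′} → S ⊆ S′ → Territory D S′ ⊆ Territory D S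
  territory-antitone {D} {S} {S′} S⊆S′ v∈ with ∈subsetOf⁻ (InTerritory? D S′) v∈
  ... | x , x∈D , j , j≤c , (x⊕j∉S′ , clear) , rest =
    ∈subsetOf⁺ (InTerritory? D S) (x , x∈D , j , j≤c , (x⊕j∉S′ ∘ S⊆S′ , clear) , rest)

  territory-empty : ∀ {D S} → (∀ x → x ∉ D) → ∣ Territory D S ∣ ≡ 0
  territory-empty {D} {S} D-empty = n≤0⇒n≡0 (≤-trans (p⊆q⇒∣p∣≤∣q∣ Territory⊆∅) (≤-reflexive (∣⊥∣≡0 N)))
    where
    Territory⊆∅ : Territory D S ⊆ ∅
    Territory⊆∅ v∈ = contradiction (proj₁ (proj₂ (∈subsetOf⁻ (InTerritory? D S) v∈))) (D-empty _)

  territory-full : ∀ {D S} → (∀ v → Near D v) → Disjoint D S → ∀ v → v ∈ Territory D S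
  territory-full {D} {S} near disj v with occupied-before v (near (v ⊖ suc k))
  ... | i , 1≤i , i≤c , v⊖i∈D with least (λ i → (1 ≤? i) ×-dec (v ⊖ i ∈? D)) (1≤i , v⊖i∈D)
  ... | i₀ , i₀≤i , (1≤i₀ , x∈D) , i₀-least with occupied-after (v ⊖ i₀) (near (v ⊖ i₀ ⊕ suc k))
  ... | j , 1≤j , j≤c , x⊕j∈D with least (λ j → (1 ≤? j) ×-dec (v ⊖ i₀ ⊕ j ∈? D)) (1≤j , x⊕j∈D)
  ... | j₀ , j₀≤j , (1≤j₀ , x⊕j₀∈D) , j₀-least =
    ∈subsetOf⁺ (InTerritory? D S)
      (x , x∈D , j₀ , ≤-trans j₀≤j j≤c , (disj x⊕j₀∈D , clear) , i₀ , i₀≤j₀ , 1≤i₀ , ⊖-⊕ v i₀)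
    where
    x = v ⊖ i₀
    clear : ∀ {l} → l < j₀ → 1 ≤ l → x ⊕ l ∉ D
    clear l<j₀ 1≤l x⊕l∈D = j₀-least l<j₀ (1≤l , x⊕l∈D)
    i₀≤j₀ : i₀ ≤ j₀
    i₀≤j₀ with i₀ ≤? j₀
    ... | yes i₀≤j₀ = i₀≤j₀
    ... | no i₀≰j₀  = contradiction
      (m<n⇒0<n∸m j₀<i₀ , subst (_∈ D) (⊕⇒⊖ (i₀ ∸ j₀) x⊕j₀⊕[i₀∸j₀]≡v) x⊕j₀∈D)
      (i₀-least (∸-monoʳ-< 1≤j₀ (<⇒≤ j₀<i₀)))
      where
      j₀<i₀ = ≰⇒> i₀≰j₀
      x⊕j₀⊕[i₀∸j₀]≡v : x ⊕ j₀ ⊕ (i₀ ∸ j₀) ≡ v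
      x⊕j₀⊕[i₀∸j₀]≡v = trans (⊕-∸ x (<⇒≤ j₀<i₀)) (⊖-⊕ v i₀)

  N≤∣territory∣ : ∀ {D S} → (∀ v → Near D v) → Disjoint D S → N ≤ ∣ Territory D S ∣
  N≤∣territory∣ {D} {S} near disj =
    subst (_≤ ∣ Territory D S ∣) (∣⊤∣≡n N) (p⊆q⇒∣p∣≤∣q∣ {p = ⊤} λ {v} _ → territory-full near disj v)

  territory-shrinks : ∀ {D S x q} → x ∈ D → Gap D x → 1 ≤ q → q ≤ c → x ⊕ q ∉ S →
                      (∀ {j} → q < j → j ≤ c → x ⊕ j ∈ S) → Territory D (S ∪ ⁅ x ⊕ q ⁆) ⊂ Territory D S
  territory-shrinks {D} {S} {x} {q} x∈D gap 1≤q q≤c s∉S above =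
    territory-antitone (p⊆p∪q ⁅ x ⊕ q ⁆) , x ⊕ q , s∈ , s∉
    where
    s∈ : x ⊕ q ∈ Territory D S
    s∈ = ∈subsetOf⁺ (InTerritory? D S)
           (x , x∈D , q , q≤c , (s∉S , λ l<q 1≤l → gap 1≤l (≤-trans (<⇒≤ l<q) q≤c)) , q , ≤-refl , 1≤q , refl)
    s∉ : x ⊕ q ∉ Territory D (S ∪ ⁅ x ⊕ q ⁆)
    s∉ s∈′ with ∈subsetOf⁻ (InTerritory? D (S ∪ ⁅ x ⊕ q ⁆)) s∈′
    ... | y , y∈D , j , j≤c , (y⊕j∉S′ , clear) , i , i≤j , 1≤i , y⊕i≡s with m≤n⇒m<n∨m≡n i≤j
    ...   | inj₂ refl = y⊕j∉S′ (subst (_∈ S ∪ ⁅ x ⊕ q ⁆) (sym y⊕i≡s) (q⊆p∪q S _ (x∈⁅x⁆ (x ⊕ q))))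
    ...   | inj₁ i<j with <-cmp q i
    ...     | tri≈ _ refl _ =
      y⊕j∉S′ (p⊆p∪q _ (subst (λ z → z ⊕ j ∈ S) (sym (⊕-cancelʳ {x = y} {y = x} q y⊕i≡s)) (above i<j j≤c)))
    ...     | tri< q<i _ _  = clear (≤-<-trans (m∸n≤m i q) i<j) (m<n⇒0<n∸m q<i)
                                (subst (_∈ D) (sym (⊕-∸-cancel {x = x} {y = y} (<⇒≤ q<i) y⊕i≡s)) x∈D)
    ...     | tri> _ _ i<q  = gap (m<n⇒0<n∸m i<q) (≤-trans (m∸n≤m q i) q≤c)
                                (subst (_∈ D) (sym (⊕-∸-cancel {x = y} {y = x} (<⇒≤ i<q) (sym y⊕i≡s))) y∈D)

  gap-exists : ∀ {D v y} → ¬ Near D v → y ∈ D → ∃ λ x → x ∈ D × Gap D x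
  gap-exists {D} {v} {y} ¬near y∈D
    with least (λ i → (1 ≤? i) ×-dec (v ⊖ i ∈? D)) (1≤e , subst (_∈ D) y≡v⊖e y∈D)
    where
    e = toℕ v + N ∸ toℕ y
    1≤e : 1 ≤ e
    1≤e = m<n⇒0<n∸m (≤-trans (toℕ<n y) (m≤n+m N (toℕ v)))
    y≡v⊖e : y ≡ v ⊖ e
    y≡v⊖e = ⊕⇒⊖ e (trans (mod-cong (toℕ y + e) (toℕ v + 1 * N) (cong (_% N) y+e≡v+N)) (⊕-multiple v 1))
      where
      y+e≡v+N : toℕ y + e ≡ toℕ v + 1 * N
      y+e≡v+N = trans (m+[n∸m]≡n (≤-trans (<⇒≤ (toℕ<n y)) (m≤n+m N (toℕ v))))
                      (cong (toℕ v +_) (sym (*-identityˡ N)))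
  ... | i₀ , _ , (1≤i₀ , x∈D) , i₀-least = x , x∈D , gap
    where
    x = v ⊖ i₀
    k<i₀ : k < i₀
    k<i₀ with k <? i₀
    ... | yes k<i₀ = k<i₀
    ... | no k≮i₀  =
      contradiction (k ∸ i₀ , ≤-trans (m∸n≤m k i₀) (m≤m+n k k) , subst (_∈ D) (sym (⊕⇒⊖ i₀ y⊕i₀≡v)) x∈D) ¬near
      where
      y⊕i₀≡v : v ⊖ k ⊕ (k ∸ i₀) ⊕ i₀ ≡ v
      y⊕i₀≡v = trans (trans (⊕-assoc (v ⊖ k) (k ∸ i₀) i₀) (cong (v ⊖ k ⊕_) (m∸n+n≡m (≮⇒≥ k≮i₀)))) (⊖-⊕ v k)
    gap : Gap D x
    gap {l} 1≤l l≤c x⊕l∈D with l <? i₀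
    ... | yes l<i₀ = i₀-least (∸-monoʳ-< 1≤l (<⇒≤ l<i₀))
      (m<n⇒0<n∸m l<i₀ , subst (_∈ D) (⊕⇒⊖ (i₀ ∸ l) (trans (⊕-∸ x (<⇒≤ l<i₀)) (⊖-⊕ v i₀))) x⊕l∈D)
    ... | no l≮i₀  = ¬near (k + (l ∸ i₀) , +-monoʳ-≤ k l∸i₀≤k , subst (_∈ D) x⊕l≡ x⊕l∈D)
      where
      l∸i₀≤k : l ∸ i₀ ≤ k
      l∸i₀≤k = ≤-trans (∸-mono (subst (l ≤_) c≡1+k+k l≤c) k<i₀) (≤-reflexive (m+n∸m≡n (suc k) k))
      x⊕l≡ : x ⊕ l ≡ v ⊖ k ⊕ (k + (l ∸ i₀))
      x⊕l≡ = begin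
        x ⊕ l                       ≡⟨ ⊕-∸ x (≮⇒≥ l≮i₀) ⟨
        x ⊕ i₀ ⊕ (l ∸ i₀)           ≡⟨ cong (_⊕ (l ∸ i₀)) (⊖-⊕ v i₀) ⟩
        v ⊕ (l ∸ i₀)                ≡⟨ cong (_⊕ (l ∸ i₀)) (⊖-⊕ v k) ⟨
        v ⊖ k ⊕ k ⊕ (l ∸ i₀)        ≡⟨ ⊕-assoc (v ⊖ k) k (l ∸ i₀) ⟩
        v ⊖ k ⊕ (k + (l ∸ i₀))      ∎
        where open ≡-Reasoning

module CycleLowerBound (n k b₀ : ℕ) where

  open CycleTerritory n k

  b = suc b₀
  d = b * c ∸ 1

  1+d≡bc : suc d ≡ b * c
  1+d≡bc = trans (+-comm 1 d) (m∸n+n≡m (*-mono-≤ (s≤s (z≤n {b₀})) (subst (1 ≤_) (sym c≡1+k+k) (s≤s z≤n))))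

  StallerWindow : Subset N → Set
  StallerWindow S = ∃ λ x → ∀ {l} → 1 ≤ l → l ≤ c → x ⊕ l ∈ S

  window-blocks : ∀ {D S} → StallerWindow S → Disjoint D S → ¬ Dominates G D
  window-blocks (x , window) disj dom with occupied-after x (dominated⇒near (dom (x ⊕ suc k)))
  ... | j , 1≤j , j≤c , x⊕j∈D = disj x⊕j∈D (window 1≤j j≤c)

  disjoint-after-move : ∀ {D T S} → Disjoint D S → (∀ v → v ∈ T → Free D S v) → Disjoint (D ∪ T) S
  disjoint-after-move {D} {T} disj T-free v∈D∪T = [ disj , (λ v∈T → proj₂ (T-free _ v∈T)) ]′ (x∈p∪q⁻ D T v∈D∪T)

  disjoint-after-reply : ∀ {D S s} → Disjoint D S → s ∉ D → Disjoint D (S ∪ ⁅ s ⁆)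
  disjoint-after-reply disj s∉D v∈D = x∉p∪⁅y⁆ (disj v∈D) λ { refl → s∉D v∈D }

  window-wins : ∀ r {D S} → StallerWindow S → Disjoint D S → ¬ DomWins G b r D S
  window-wins (suc r) window disj (T , _ , T-free , inj₁ dom) =
    window-blocks window (disjoint-after-move disj T-free) dom
  window-wins (suc r) (x , window) disj (T , _ , T-free , inj₂ ((w , w∉D∪T , w∉S) , play)) =
    window-wins r (x , λ 1≤l l≤c → p⊆p∪q ⁅ w ⁆ (window 1≤l l≤c))
                  (disjoint-after-reply (disjoint-after-move disj T-free) w∉D∪T) (play w w∉D∪T w∉S)

  stallerReply : ∀ {D S} → ¬ (∀ v → Near D v) → Σ (Fin N) (Free D S) →
                 StallerWindow S ⊎ Σ (Fin N) λ s → Free D S s × ∣ Territory D (S ∪ ⁅ s ⁆) ∣ ≤ pred ∣ Territory D S ∣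
  stallerReply {D} {S} ¬allNear (w , w-free) with ¬∀⟶∃¬ N (Near D) (Near? D) ¬allNear | any? (_∈? D)
  ... | _ , _      | no D-empty =
    inj₂ (w , w-free , ≤-trans (≤-reflexive (territory-empty λ x x∈D → D-empty (x , x∈D))) z≤n)
  ... | v , ¬near | yes (y , y∈D) with gap-exists {v = v} ¬near y∈D
  ...   | x , x∈D , gap with greatestUpTo (λ q → (1 ≤? q) ×-dec ¬? (x ⊕ q ∈? S)) c
  ...     | inj₂ none = inj₁ (x , λ 1≤l l≤c → decidable-stable (x ⊕ _ ∈? S) λ x⊕l∉S → none l≤c (1≤l , x⊕l∉S))
  ...     | inj₁ (q , q≤c , (1≤q , x⊕q∉S) , above) =
    inj₂ (x ⊕ q , (gap 1≤q q≤c , x⊕q∉S) ,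
          <⇒≤pred (p⊂q⇒∣p∣<∣q∣ (territory-shrinks x∈D gap 1≤q q≤c x⊕q∉S taken)))
    where
    taken : ∀ {j} → q < j → j ≤ c → x ⊕ j ∈ S
    taken {j} q<j j≤c = decidable-stable (x ⊕ j ∈? S) λ x⊕j∉S → above q<j j≤c (≤-trans (s≤s z≤n) q<j , x⊕j∉S)

  td+bc≤[t+1+r]d+1 : ∀ t r → t * d + b * c ≤ (t + suc r) * d + 1
  td+bc≤[t+1+r]d+1 t r = begin
    t * d + b * c         ≡⟨ cong (t * d +_) 1+d≡bc ⟨
    t * d + suc d         ≡⟨ lemma t d ⟩
    (t + 1) * d + 1       ≤⟨ +-monoˡ-≤ 1 (*-monoˡ-≤ d (+-monoʳ-≤ t (s≤s z≤n))) ⟩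
    (t + suc r) * d + 1   ∎
    where
    open ≤-Reasoning
    lemma : ∀ t d → t * d + suc d ≡ (t + 1) * d + 1
    lemma = solve-∀

  pred[td+bc]≡[1+t]d : ∀ t → pred (t * d + b * c) ≡ suc t * d
  pred[td+bc]≡[1+t]d t = begin
    pred (t * d + b * c)   ≡⟨ cong (λ m → pred (t * d + m)) 1+d≡bc ⟨
    pred (t * d + suc d)   ≡⟨ cong pred (+-suc (t * d) d) ⟩
    t * d + d              ≡⟨ +-comm (t * d) d ⟩
    suc t * d              ∎
    where open ≡-Reasoning

  mutual
    lowerBound : ∀ r {t D S} → Disjoint D S → ∣ Territory D S ∣ ≤ t * d → DomWins G b r D S →
                 N ≤ (t + r) * d + 1
    lowerBound (suc r) {t} {D} {S} disj ∣Terr∣≤td (T , ∣T∣≤b , T-free , outcome) =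
      afterMove r {t} (disjoint-after-move disj T-free) (∣territory-step∣ D T S ∣Terr∣≤td ∣T∣≤b) outcome

    afterMove : ∀ r {t D S} → Disjoint D S → ∣ Territory D S ∣ ≤ t * d + b * c → StallerToMove G b r D S →
                N ≤ (t + suc r) * d + 1
    afterMove r {t} {D} disj ∣Terr∣≤ outcome with all? (Near? D)
    ... | yes allNear = ≤-trans (N≤∣territory∣ allNear disj) (≤-trans ∣Terr∣≤ (td+bc≤[t+1+r]d+1 t r))
    ... | no ¬allNear with outcome
    ...   | inj₁ dom = contradiction (λ v → dominated⇒near (dom v)) ¬allNear
    ...   | inj₂ ((w , w∉D , w∉S) , play) with stallerReply ¬allNear (w , w∉D , w∉S)
    ...     | inj₁ (x , window) = contradiction (play w w∉D w∉S)
      (window-wins r (x , λ 1≤l l≤c → p⊆p∪q ⁅ w ⁆ (window 1≤l l≤c)) (disjoint-after-reply disj w∉D))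
    ...     | inj₂ (s , (s∉D , s∉S) , shrunk) = subst (λ m → N ≤ m * d + 1) (sym (+-suc t r))
      (lowerBound r {suc t} (disjoint-after-reply disj s∉D)
        (≤-trans shrunk (≤-trans (pred-mono-≤ ∣Terr∣≤) (≤-reflexive (pred[td+bc]≡[1+t]d t))))
        (play s s∉D s∉S))

  cycleLowerBound : ∀ r → DomWins G b r ∅ ∅ → n ≤ r * d
  cycleLowerBound r win = ≤-pred (subst (N ≤_) (+-comm (r * d) 1)
    (lowerBound r {0} (λ v∈∅ → contradiction v∈∅ ∉⊥) (≤-reflexive (territory-empty λ _ → ∉⊥)) win))

-- Ceiling division

ceilDiv-least : ∀ a d r → 1 ≤ d → a ≤ r * d → ceilDiv a d ≤ r
ceilDiv-least a (suc d′) r _ a≤rd = ≤-pred (m<n*o⇒m/o<n (begin-strict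
  a + d′                  ≤⟨ +-monoˡ-≤ d′ a≤rd ⟩
  r * suc d′ + d′         <⟨ n<1+n _ ⟩
  suc (r * suc d′ + d′)   ≡⟨ cong suc (+-comm (r * suc d′) d′) ⟩
  suc r * suc d′          ∎))
  where open ≤-Reasoning

ceilDiv-spec : ∀ a d → 1 ≤ a → 1 ≤ d → ∃ λ M → ceilDiv a d ≡ suc M × M * d ≤ a × a ≤ M * d + d
ceilDiv-spec a (suc d′) 1≤a _
  with (a + d′) / suc d′ in q≡ | m≥n⇒m/n>0 {a + d′} {suc d′} (+-monoˡ-≤ d′ 1≤a)
... | suc M | _ = M , refl , Md≤a , a≤Md+d
  where
  open ≤-Reasoning
  d = suc d′
  Md+d≤a+d′ : M * d + d ≤ a + d′
  Md+d≤a+d′ = begin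
    M * d + d          ≡⟨ +-comm (M * d) d ⟩
    suc M * d          ≡⟨ cong (_* d) q≡ ⟨
    (a + d′) / d * d   ≤⟨ m/n*n≤m (a + d′) d ⟩
    a + d′             ∎
  Md≤a : M * d ≤ a
  Md≤a = +-cancelʳ-≤ d′ (M * d) a (≤-trans (+-monoʳ-≤ (M * d) (n≤1+n d′)) Md+d≤a+d′)
  a≤Md+d : a ≤ M * d + d
  a≤Md+d = +-cancelʳ-≤ d′ a (M * d + d) (begin
    a + d′                           ≡⟨ m≡m%n+[m/n]*n (a + d′) d ⟩
    (a + d′) % d + (a + d′) / d * d  ≤⟨ +-monoˡ-≤ _ (≤-pred (m%n<n (a + d′) d)) ⟩
    d′ + (a + d′) / d * d            ≡⟨ cong (λ q → d′ + q * d) q≡ ⟩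
    d′ + (d + M * d)                 ≡⟨ +-comm d′ (d + M * d) ⟩
    d + M * d + d′                   ≡⟨ cong (_+ d′) (+-comm d (M * d)) ⟩
    M * d + d + d′                   ∎)

theorem1p4 : (b k n : ℕ) → 1 ≤ b → 1 ≤ k → 2 ≤ n → b ≤ n → k ≤ n →
    GammaMB≡ (Power (PathEdge n) k) b (ceilDiv (n ∸ 1) (b * (2 * k + 1) ∸ 1))
    × GammaMB≡ (Power (CycleEdge n) k) b (ceilDiv (n ∸ 1) (b * (2 * k + 1) ∸ 1))
theorem1p4 (suc b₀) (suc k₀) (suc n) _ _ (s≤s 1≤n) _ _ =
  (pathWins , pathLower) , (DomWins-mono (PathPower⊆CyclePower k) _ pathWins , cycleLower)
  where
  k = suc k₀
  d = suc b₀ * (2 * k + 1) ∸ 1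
  1≤d : 1 ≤ d
  1≤d = subst (1 ≤_) (sym ([1+b₀][2k+1]∸1≡k+k+b₀[2k+1] b₀ k₀)) (s≤s z≤n)
  pathWins : DomWins (Power (PathEdge (suc n)) k) (suc b₀) (ceilDiv n d) ∅ ∅
  pathWins with ceilDiv-spec n d 1≤n 1≤d
  ... | M , γ≡1+M , Md≤n , n≤Md+d rewrite γ≡1+M = PathBlocks.pathUpperBound b₀ k₀ n M Md≤n n≤Md+d
  cycleLower : ∀ r → DomWins (Power (CycleEdge (suc n)) k) (suc b₀) r ∅ ∅ → ceilDiv n d ≤ r
  cycleLower r = ceilDiv-least n d r 1≤d ∘ CycleLowerBound.cycleLowerBound n k b₀ r
  pathLower : ∀ r → DomWins (Power (PathEdge (suc n)) k) (suc b₀) r ∅ ∅ → ceilDiv n d ≤ r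
  pathLower r = cycleLower r ∘ DomWins-mono (PathPower⊆CyclePower k) r
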